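{- Let $n\ge2$, $E=[n]$, $k\ge1$, and let $\mathcal{G}=(G_1\subsetneq\dots\subsetneq G_k)$ be subsets of $E$ with $|G_k|\le n-2$. Then the chain product $M_{\mathcal{G}}=H_{G_1}\wedge\dots\wedge H_{G_k}$ is the transversal matroid $$M\bigl[G_1^{\oplus|G_1|},\,G_2^{\oplus|G_2\setminus G_1|-1},\,\dots,\,G_k^{\oplus|G_k\setminus G_{k-1}|-1},\,E^{\oplus|E\setminus G_k|-1}\bigr].$$
   Context: For $G\subseteq E$ with $|G|\le n-2$, $H_G:=U_{|G|,G}\oplus U_{|E\setminus G|-1,E\setminus G}$ (the loopfree corank-one matroid with coloop set $G$). $M\wedge N:=(M^*\vee N^*)^*$, where $M\vee N$ is matroid union. For a family $(A_1,\dots,A_m)$ of subsets of $E$, $M[A_1,\dots,A_m]$ is the transversal matroid whose independent sets are the partial transversals: sets $S\subseteq E$ admitting a bijection $\psi:J\to S$ from some $J\subseteq[m]$ with $\psi(j)\in A_j$ for all $j\in J$. $S^{\oplus l}$ denotes the family consisting of $l$ copies of $S$ (empty if $l=0$). -}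

module Defs where

open import Data.Nat using (ℕ; zero; suc; _∸_; _≤_)
open import Data.Fin using (Fin)
open import Data.Fin.Subset using (Subset; _∈_; _⊆_; _⊂_; _∩_; _∪_; _─_; ∁; ∣_∣; ⊤)
open import Data.Maybe using (Maybe; just)
open import Data.List using (List; []; _∷_; _++_; replicate; length; lookup)
open import Data.Vec using (Vec; []; _∷_)
open import Data.Product using (Σ; _×_; ∃)
open import Relation.Binary.PropositionalEquality using (_≡_)
open import Function.Bundles using (_⇔_)

-- A matroid on E = Fin n, given by its independence predicate.
Indep : ℕ → Set₁
Indep n = Subset n → Set

U : ∀ {n} → ℕ → Subset n → Indep n
U r S I = (I ⊆ S) × (∣ I ∣ ≤ r)

-- Direct sum of a matroid M on ground set S and N on ground set T (S, T disjoint, S ∪ T = E).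
directSum : ∀ {n} → Subset n → Indep n → Subset n → Indep n → Indep n
directSum S M T N I = M (I ∩ S) × N (I ∩ T)

H : ∀ {n} → Subset n → Indep n
H G = directSum G (U ∣ G ∣ G) (⊤ ─ G) (U (∣ ⊤ ─ G ∣ ∸ 1) (⊤ ─ G))

IsBasis : ∀ {n} → Indep n → Subset n → Set
IsBasis M B = M B × (∀ I → M I → B ⊆ I → I ≡ B)

dual : ∀ {n} → Indep n → Indep n
dual M I = Σ _ λ B → IsBasis M B × (I ⊆ ∁ B)

_∨M_ : ∀ {n} → Indep n → Indep n → Indep n
(M ∨M N) S = Σ _ λ I → Σ _ λ J → M I × N J × (S ≡ I ∪ J)

_∧M_ : ∀ {n} → Indep n → Indep n → Indep n
M ∧M N = dual (dual M ∨M dual N)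

chainProdAcc : ∀ {n m} → Indep n → Vec (Subset n) m → Indep n
chainProdAcc acc [] = acc
chainProdAcc acc (G ∷ Gs) = chainProdAcc (acc ∧M H G) Gs

chainProd : ∀ {n m} → Vec (Subset n) (suc m) → Indep n
chainProd (G ∷ Gs) = chainProdAcc (H G) Gs

-- Transversal matroid M[A_1,…,A_m]: S is independent iff it is a partial
-- transversal, i.e. there is a bijection ψ : J → S (J ⊆ [m]) with ψ(j) ∈ A_j.
-- ψ is encoded as a partial map Fin m → Maybe (Fin n) (domain J), injective, with image S.
Transversal : ∀ {n} → List (Subset n) → Indep n
Transversal {n} A S =
  Σ (Fin (length A) → Maybe (Fin n)) λ ψ →
    (∀ j x → ψ j ≡ just x → x ∈ lookup A j) ×
    (∀ j j' x → ψ j ≡ just x → ψ j' ≡ just x → j ≡ j') ×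
    (∀ x → (x ∈ S) ⇔ ∃ λ j → ψ j ≡ just x)

-- Strictly increasing chain G_1 ⊊ … ⊊ G_k (⊂ is strict inclusion in the library).
data StrictChain {n} : ∀ {m} → Vec (Subset n) m → Set where
  single : ∀ {G} → StrictChain (G ∷ [])
  cons   : ∀ {m G G'} {Gs : Vec (Subset n) m} →
           G ⊂ G' → StrictChain (G' ∷ Gs) → StrictChain (G ∷ G' ∷ Gs)

familyTail : ∀ {n m} → Subset n → Vec (Subset n) m → List (Subset n)
familyTail prev [] = replicate (∣ ⊤ ─ prev ∣ ∸ 1) ⊤
familyTail prev (G ∷ Gs) = replicate (∣ G ─ prev ∣ ∸ 1) G ++ familyTail G Gs

chainFamily : ∀ {n m} → Vec (Subset n) (suc m) → List (Subset n)
chainFamily (G ∷ Gs) = replicate ∣ G ∣ G ++ familyTail G Gs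

module Submission where

-- Both matroids are shown equal to one explicitly described independence
-- predicate, Room: S is independent iff ∣ S ∖ Gᵢ ∣ + (k − i + 1) ≤ ∣ E ∖ Gᵢ ∣ for all i.
--
-- H_G is the dual of the rank-one matroid L(G) = U_{1,E∖G},
-- and for a descending chain C₁ ⊋ … ⊋ Cₖ the "layered" matroid L(C₁,…,Cₖ)
-- (∣ I ∣ ≤ k, ∣ I ∩ Cᵢ ∣ ≤ k − i) satisfies L(Cs) ∨ L(G) = L(G, Cs) for G ⊋ C₁.
-- Every independent set of L(Cs) extends to one of size k, so L(Cs)** = L(Cs)
-- and M ∧ H_G = (M* ∨ H_G*)* unfolds to M_𝒢 = L(Gₖ,…,G₁)*.  Avoiding a basis of
-- L(Gₖ,…,G₁) is then translated into Room (a basis is built greedily from the top).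
--
-- Peeling members off the family gives
-- Transversal (X^{⊕a}, A) = U_{a,X} ∨ Transversal A, and the union of U_{a,X} with
-- a matroid "∣ S ∣ ≤ b and Q S" is computed explicitly; block by block this
-- yields Room again.

open import Defs
open import Data.Nat using (ℕ; zero; suc; _+_; _∸_; _≤_; _<_; z≤n; s≤s)
open import Data.Nat.Properties
open import Data.Fin using (Fin; zero; suc) renaming (_≟_ to _≟F_)
open import Data.Fin.Properties using (¬Fin0) renaming (suc-injective to fsuc-injective; 0≢1+n to fzero≢fsuc)
open import Data.Maybe using (Maybe; just; nothing)
open import Data.Maybe.Properties using (just-injective)
open import Data.Fin.Subset
open import Data.Fin.Subset.Properties
open import Data.Bool using (true; false)
open import Data.Vec using (Vec; []; _∷_; here; there; last)
open import Data.List using (List; []; _∷_; length; lookup; replicate; _++_)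
open import Data.List.Properties using (++-identityʳ)
open import Data.Unit using (tt) renaming (⊤ to Unit)
open import Data.Product using (_×_; _,_; proj₁; proj₂; ∃)
open import Data.Sum using (inj₁; inj₂)
open import Data.Empty using (⊥-elim)
open import Relation.Nullary using (yes; no)
open import Relation.Binary.PropositionalEquality
open import Function.Bundles using (_⇔_; mk⇔; Equivalence)
import Function.Properties.Equivalence as ⇔

open Equivalence using (to; from)

private variable n : ℕ

-- Elementary facts about finite sets and their cardinalities

x∈p─q⁻ : ∀ {x : Fin n} (p q : Subset n) → x ∈ p ─ q → x ∈ p × x ∉ q
x∈p─q⁻ (true ∷ p) (false ∷ q) here = here , λ ()
x∈p─q⁻ (_ ∷ p) (true ∷ q) (there x∈) = let a , b = x∈p─q⁻ p q x∈ in there a , λ { (there z) → b z }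
x∈p─q⁻ (_ ∷ p) (false ∷ q) (there x∈) = let a , b = x∈p─q⁻ p q x∈ in there a , λ { (there z) → b z }

∁-involutive : (p : Subset n) → ∁ (∁ p) ≡ p
∁-involutive [] = refl
∁-involutive (true ∷ p) = cong (true ∷_) (∁-involutive p)
∁-involutive (false ∷ p) = cong (false ∷_) (∁-involutive p)

∣p∣≡∣p∩q∣+∣p─q∣ : (p q : Subset n) → ∣ p ∣ ≡ ∣ p ∩ q ∣ + ∣ p ─ q ∣
∣p∣≡∣p∩q∣+∣p─q∣ [] [] = refl
∣p∣≡∣p∩q∣+∣p─q∣ (true ∷ p) (true ∷ q) = cong suc (∣p∣≡∣p∩q∣+∣p─q∣ p q)
∣p∣≡∣p∩q∣+∣p─q∣ (true ∷ p) (false ∷ q) = trans (cong suc (∣p∣≡∣p∩q∣+∣p─q∣ p q)) (sym (+-suc _ _))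
∣p∣≡∣p∩q∣+∣p─q∣ (false ∷ p) (true ∷ q) = ∣p∣≡∣p∩q∣+∣p─q∣ p q
∣p∣≡∣p∩q∣+∣p─q∣ (false ∷ p) (false ∷ q) = ∣p∣≡∣p∩q∣+∣p─q∣ p q

∣p∪q∣+∣p∩q∣≡∣p∣+∣q∣ : (p q : Subset n) → ∣ p ∪ q ∣ + ∣ p ∩ q ∣ ≡ ∣ p ∣ + ∣ q ∣
∣p∪q∣+∣p∩q∣≡∣p∣+∣q∣ [] [] = refl
∣p∪q∣+∣p∩q∣≡∣p∣+∣q∣ (true ∷ p) (true ∷ q) =
  cong suc (trans (+-suc _ _) (trans (cong suc (∣p∪q∣+∣p∩q∣≡∣p∣+∣q∣ p q)) (sym (+-suc _ _))))
∣p∪q∣+∣p∩q∣≡∣p∣+∣q∣ (true ∷ p) (false ∷ q) = cong suc (∣p∪q∣+∣p∩q∣≡∣p∣+∣q∣ p q)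
∣p∪q∣+∣p∩q∣≡∣p∣+∣q∣ (false ∷ p) (true ∷ q) = trans (cong suc (∣p∪q∣+∣p∩q∣≡∣p∣+∣q∣ p q)) (sym (+-suc _ _))
∣p∪q∣+∣p∩q∣≡∣p∣+∣q∣ (false ∷ p) (false ∷ q) = ∣p∪q∣+∣p∩q∣≡∣p∣+∣q∣ p q

∣p∪q∣≤∣p∣+∣q∣ : (p q : Subset n) → ∣ p ∪ q ∣ ≤ ∣ p ∣ + ∣ q ∣
∣p∪q∣≤∣p∣+∣q∣ p q = ≤-trans (m≤m+n _ _) (≤-reflexive (∣p∪q∣+∣p∩q∣≡∣p∣+∣q∣ p q))

∣⊥∣≤ : ∀ c → ∣ ⊥ {n} ∣ ≤ c
∣⊥∣≤ {n} c = ≤-trans (≤-reflexive (∣⊥∣≡0 n)) z≤n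

∣∅∣≡0 : {p : Subset n} → Empty p → ∣ p ∣ ≡ 0
∣∅∣≡0 {n} e = trans (cong ∣_∣ (Empty-unique e)) (∣⊥∣≡0 n)

Disjoint : Subset n → Subset n → Set
Disjoint p q = ∀ {y} → y ∈ p → y ∉ q

∣p∩q∣≡0 : {p q : Subset n} → Disjoint p q → ∣ p ∩ q ∣ ≡ 0
∣p∩q∣≡0 {p = p} {q} disj = ∣∅∣≡0 λ (_ , y∈) → let y∈p , y∈q = x∈p∩q⁻ p q y∈ in disj y∈p y∈q

∣p∣≤0⇒p≡⊥ : {p : Subset n} → ∣ p ∣ ≤ 0 → p ≡ ⊥
∣p∣≤0⇒p≡⊥ {p = p} le = Empty-unique λ (x , x∈p) → <⇒≱ (x∈p⇒∣p-x∣<∣p∣ x∈p) (≤-trans le z≤n)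

x∈p⇒0<∣p∣ : ∀ {x : Fin n} {p : Subset n} → x ∈ p → 0 < ∣ p ∣
x∈p⇒0<∣p∣ x∈p = ≤-trans (s≤s z≤n) (x∈p⇒∣p-x∣<∣p∣ x∈p)

∣p∪q∣≡∣p∣+∣q∣ : (p q : Subset n) → Disjoint p q → ∣ p ∪ q ∣ ≡ ∣ p ∣ + ∣ q ∣
∣p∪q∣≡∣p∣+∣q∣ p q disj = begin
  ∣ p ∪ q ∣                 ≡⟨ sym (+-identityʳ _) ⟩
  ∣ p ∪ q ∣ + 0             ≡⟨ cong (∣ p ∪ q ∣ +_) (sym (∣p∩q∣≡0 disj)) ⟩
  ∣ p ∪ q ∣ + ∣ p ∩ q ∣     ≡⟨ ∣p∪q∣+∣p∩q∣≡∣p∣+∣q∣ p q ⟩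
  ∣ p ∣ + ∣ q ∣             ∎
  where open ≡-Reasoning

disjoint-≤ : (p q r : Subset n) → p ⊆ r → q ⊆ r → Disjoint p q → ∣ p ∣ + ∣ q ∣ ≤ ∣ r ∣
disjoint-≤ p q r p⊆r q⊆r disj = ≤-trans (≤-reflexive (sym (∣p∪q∣≡∣p∣+∣q∣ p q disj))) (p⊆q⇒∣p∣≤∣q∣ pq⊆r)
  where
  pq⊆r : p ∪ q ⊆ r
  pq⊆r x∈ with x∈p∪q⁻ p q x∈
  ... | inj₁ x∈p = p⊆r x∈p
  ... | inj₂ x∈q = q⊆r x∈q

nothing-outside : (p q : Subset n) → Empty (q ─ p) → q ⊆ p
nothing-outside p q e {x} x∈q with x ∈? p
... | yes x∈p = x∈p
... | no x∉p = ⊥-elim (e (x , x∈p∧x∉q⇒x∈p─q x∈q x∉p))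

pick-outside : (p q : Subset n) → ∣ p ∣ < ∣ q ∣ → ∃ λ x → x ∈ q × x ∉ p
pick-outside p q lt with nonempty? (q ─ p)
... | yes (x , x∈) = x , x∈p─q⁻ q p x∈
... | no e = ⊥-elim (<⇒≱ lt (p⊆q⇒∣p∣≤∣q∣ (nothing-outside p q e)))

⊆-card-≡ : ∀ {p q : Subset n} → p ⊆ q → ∣ q ∣ ≤ ∣ p ∣ → p ≡ q
⊆-card-≡ {p = p} {q} p⊆q le with nonempty? (q ─ p)
... | yes (x , x∈) = let x∈q , x∉p = x∈p─q⁻ q p x∈
                     in ⊥-elim (<⇒≱ (p⊂q⇒∣p∣<∣q∣ (p⊆q , x , x∈q , x∉p)) le)
... | no e = ⊆-antisym p⊆q (nothing-outside p q e)

⊆-split : {p S : Subset n} → p ⊆ S → p ∪ (S ─ p) ≡ S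
⊆-split {p = p} {S} p⊆S = ⊆-antisym ⊆S ⊇S
  where
  ⊆S : p ∪ (S ─ p) ⊆ S
  ⊆S x∈ with x∈p∪q⁻ p (S ─ p) x∈
  ... | inj₁ x∈p = p⊆S x∈p
  ... | inj₂ x∈S─p = p─q⊆p S p x∈S─p
  ⊇S : S ⊆ p ∪ (S ─ p)
  ⊇S {x} x∈S with x ∈? p
  ... | yes x∈p = x∈p∪q⁺ (inj₁ x∈p)
  ... | no x∉p = x∈p∪q⁺ (inj₂ (x∈p∧x∉q⇒x∈p─q x∈S x∉p))

⁅x⁆⊆p : ∀ {x : Fin n} {p : Subset n} → x ∈ p → ⁅ x ⁆ ⊆ p
⁅x⁆⊆p x∈p y∈ = subst (_∈ _) (sym (x∈⁅y⁆⇒x≡y _ y∈)) x∈p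

⁅x⁆-disjoint : ∀ {x : Fin n} {p : Subset n} → x ∉ p → Disjoint ⁅ x ⁆ p
⁅x⁆-disjoint {p = p} x∉p y∈⁅x⁆ y∈p = x∉p (subst (_∈ p) (x∈⁅y⁆⇒x≡y _ y∈⁅x⁆) y∈p)

∣p∣≡∣q∣+∣p─q∣ : {p q : Subset n} → q ⊆ p → ∣ p ∣ ≡ ∣ q ∣ + ∣ p ─ q ∣
∣p∣≡∣q∣+∣p─q∣ {p = p} {q} q⊆p = trans (∣p∣≡∣p∩q∣+∣p─q∣ p q) (cong (λ r → ∣ r ∣ + ∣ p ─ q ∣) p∩q≡q)
  where
  p∩q≡q : p ∩ q ≡ q
  p∩q≡q = ⊆-antisym (p∩q⊆q p q) (λ x∈q → x∈p∩q⁺ (q⊆p x∈q , x∈q))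

∣p∣≡1+∣p-x∣ : ∀ {x : Fin n} {p : Subset n} → x ∈ p → ∣ p ∣ ≡ suc ∣ p - x ∣
∣p∣≡1+∣p-x∣ {x = x} {p} x∈p = trans (∣p∣≡∣q∣+∣p─q∣ (⁅x⁆⊆p x∈p)) (cong (_+ ∣ p - x ∣) (∣⁅x⁆∣≡1 x))

∣⁅x⁆∪p∣≡1+∣p∣ : ∀ {x : Fin n} {p : Subset n} → x ∉ p → ∣ ⁅ x ⁆ ∪ p ∣ ≡ suc ∣ p ∣
∣⁅x⁆∪p∣≡1+∣p∣ {x = x} {p} x∉p = trans (∣p∪q∣≡∣p∣+∣q∣ ⁅ x ⁆ p (⁅x⁆-disjoint x∉p)) (cong (_+ ∣ p ∣) (∣⁅x⁆∣≡1 x))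

∣⊤─p∣+∣p∣≡n : (p : Subset n) → ∣ ⊤ ─ p ∣ + ∣ p ∣ ≡ n
∣⊤─p∣+∣p∣≡n {n} p = begin
  ∣ ⊤ ─ p ∣ + ∣ p ∣       ≡⟨ +-comm (∣ ⊤ ─ p ∣) (∣ p ∣) ⟩
  ∣ p ∣ + ∣ ⊤ ─ p ∣       ≡⟨ cong (λ r → ∣ r ∣ + ∣ ⊤ ─ p ∣) (sym (∩-identityˡ p)) ⟩
  ∣ ⊤ ∩ p ∣ + ∣ ⊤ ─ p ∣   ≡⟨ sym (∣p∣≡∣p∩q∣+∣p─q∣ ⊤ p) ⟩
  ∣ ⊤ {n} ∣               ≡⟨ ∣⊤∣≡n n ⟩
  n                       ∎
  where open ≡-Reasoning

subset-of-size : (p : Subset n) (c : ℕ) → c ≤ ∣ p ∣ → ∃ λ q → q ⊆ p × ∣ q ∣ ≡ c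
subset-of-size {n} p zero _ = ⊥ , ⊥⊆ , ∣⊥∣≡0 n
subset-of-size p (suc c) c<∣p∣ with subset-of-size p c (<⇒≤ c<∣p∣)
... | q , q⊆p , ∣q∣≡c with pick-outside q p (subst (_< ∣ p ∣) (sym ∣q∣≡c) c<∣p∣)
... | x , x∈p , x∉q = ⁅ x ⁆ ∪ q , ⁅x⁆∪q⊆p , trans (∣⁅x⁆∪p∣≡1+∣p∣ x∉q) (cong suc ∣q∣≡c)
  where
  ⁅x⁆∪q⊆p : ⁅ x ⁆ ∪ q ⊆ p
  ⁅x⁆∪q⊆p y∈ with x∈p∪q⁻ ⁅ x ⁆ q y∈
  ... | inj₁ y∈⁅x⁆ = ⁅x⁆⊆p x∈p y∈⁅x⁆
  ... | inj₂ y∈q = q⊆p y∈q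

∣⁅x⁆∪p∩q∣≤ : (x : Fin n) (p q : Subset n) → ∣ (⁅ x ⁆ ∪ p) ∩ q ∣ ≤ ∣ ⁅ x ⁆ ∩ q ∣ + ∣ p ∩ q ∣
∣⁅x⁆∪p∩q∣≤ x p q = ≤-trans (≤-reflexive (cong ∣_∣ (∩-distribʳ-∪ q ⁅ x ⁆ p))) (∣p∪q∣≤∣p∣+∣q∣ (⁅ x ⁆ ∩ q) (p ∩ q))

∣⁅x⁆∩q∣≤1 : (x : Fin n) (q : Subset n) → ∣ ⁅ x ⁆ ∩ q ∣ ≤ 1
∣⁅x⁆∩q∣≤1 x q = ≤-trans (∣p∩q∣≤∣p∣ ⁅ x ⁆ q) (≤-reflexive (∣⁅x⁆∣≡1 x))

∣p∣≤0⇒x∉p : ∀ {x : Fin n} {p : Subset n} → ∣ p ∣ ≤ 0 → x ∉ p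
∣p∣≤0⇒x∉p ∣p∣≤0 x∈p = 1+n≰n (≤-trans (x∈p⇒0<∣p∣ x∈p) ∣p∣≤0)

∪-disjoint : {p q r : Subset n} → Disjoint p r → Disjoint q r → Disjoint (p ∪ q) r
∪-disjoint {p = p} {q} p-r q-r y∈ with x∈p∪q⁻ p q y∈
... | inj₁ y∈p = p-r y∈p
... | inj₂ y∈q = q-r y∈q

∣⊤─P∣≡∣G─P∣+∣⊤─G∣ : {P G : Subset n} → P ⊆ G → ∣ ⊤ ─ P ∣ ≡ ∣ G ─ P ∣ + ∣ ⊤ ─ G ∣
∣⊤─P∣≡∣G─P∣+∣⊤─G∣ {n} {P} {G} P⊆G = +-cancelʳ-≡ ∣ P ∣ _ _ (begin
  ∣ ⊤ ─ P ∣ + ∣ P ∣                   ≡⟨ ∣⊤─p∣+∣p∣≡n P ⟩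
  n                                   ≡⟨ sym (∣⊤─p∣+∣p∣≡n G) ⟩
  ∣ ⊤ ─ G ∣ + ∣ G ∣                   ≡⟨ cong (∣ ⊤ ─ G ∣ +_) (trans (∣p∣≡∣q∣+∣p─q∣ P⊆G) (+-comm (∣ P ∣) (∣ G ─ P ∣))) ⟩
  ∣ ⊤ ─ G ∣ + (∣ G ─ P ∣ + ∣ P ∣)     ≡⟨ sym (+-assoc (∣ ⊤ ─ G ∣) (∣ G ─ P ∣) (∣ P ∣)) ⟩
  ∣ ⊤ ─ G ∣ + ∣ G ─ P ∣ + ∣ P ∣       ≡⟨ cong (_+ ∣ P ∣) (+-comm (∣ ⊤ ─ G ∣) (∣ G ─ P ∣)) ⟩
  ∣ G ─ P ∣ + ∣ ⊤ ─ G ∣ + ∣ P ∣       ∎)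
  where open ≡-Reasoning

0<∣G─P∣ : {P G : Subset n} → P ⊂ G → 0 < ∣ G ─ P ∣
0<∣G─P∣ (_ , x , x∈G , x∉P) = x∈p⇒0<∣p∣ (x∈p∧x∉q⇒x∈p─q x∈G x∉P)

⊂⊤ : (p : Subset n) → ∣ p ∣ < n → p ⊂ ⊤
⊂⊤ {n} p ∣p∣<n =
  let x , x∈⊤ , x∉p = pick-outside p ⊤ (≤-trans ∣p∣<n (≤-reflexive (sym (∣⊤∣≡n n)))) in ⊆⊤ , x , x∈⊤ , x∉p

complement-≤ : ∀ a b p c → a + b ≡ p + c → a ≤ p ⇔ c ≤ b
complement-≤ a b p c a+b≡p+c = mk⇔
  (λ a≤p → +-cancelˡ-≤ p c b (≤-trans (≤-reflexive (sym a+b≡p+c)) (+-monoˡ-≤ b a≤p)))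
  (λ c≤b → +-cancelʳ-≤ b a p (≤-trans (≤-reflexive a+b≡p+c) (+-monoʳ-≤ p c≤b)))

∸-split : ∀ x y c → 0 < x → c ≤ y → (x ∸ 1) + (y ∸ c) ≡ (x + y) ∸ suc c
∸-split (suc x) y c _ c≤y = sym (+-∸-assoc x c≤y)

-- Equivalence of matroids, and the double dual

_≐_ : Indep n → Indep n → Set
M ≐ N = ∀ S → M S ⇔ N S

≐-refl : {M : Indep n} → M ≐ M
≐-refl S = ⇔.refl

≐-sym : {M N : Indep n} → M ≐ N → N ≐ M
≐-sym M≐N S = ⇔.sym (M≐N S)

≐-trans : {M N P : Indep n} → M ≐ N → N ≐ P → M ≐ P
≐-trans M≐N N≐P S = ⇔.trans (M≐N S) (N≐P S)

basis-resp : {M N : Indep n} → M ≐ N → ∀ B → IsBasis M B → IsBasis N B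
basis-resp M≐N B (indep , maximal) = to (M≐N B) indep , λ I indepI B⊆I → maximal I (from (M≐N I) indepI) B⊆I

dual-resp : {M N : Indep n} → M ≐ N → dual M ≐ dual N
dual-resp M≐N S = mk⇔ (λ (B , basis , S⊆∁B) → B , basis-resp M≐N B basis , S⊆∁B)
                      (λ (B , basis , S⊆∁B) → B , basis-resp (≐-sym M≐N) B basis , S⊆∁B)

∨-resp : {M M' N N' : Indep n} → M ≐ M' → N ≐ N' → (M ∨M N) ≐ (M' ∨M N')
∨-resp M≐M' N≐N' S = mk⇔
  (λ (I , J , indepI , indepJ , S≡I∪J) → I , J , to (M≐M' I) indepI , to (N≐N' J) indepJ , S≡I∪J)
  (λ (I , J , indepI , indepJ , S≡I∪J) → I , J , from (M≐M' I) indepI , from (N≐N' J) indepJ , S≡I∪J)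

∁-basis-dual : (M : Indep n) (B : Subset n) → IsBasis M B → IsBasis (dual M) (∁ B)
∁-basis-dual M B basisB@(indepB , _) = (B , basisB , ⊆-refl) , maximal
  where
  maximal : ∀ I → dual M I → ∁ B ⊆ I → I ≡ ∁ B
  maximal I (B' , (_ , maximalB') , I⊆∁B') ∁B⊆I = ⊆-antisym (subst (λ C → I ⊆ ∁ C) (sym B≡B') I⊆∁B') ∁B⊆I
    where
    B≡B' : B ≡ B'
    B≡B' = maximalB' B indepB (∁p⊆∁q⇒p⊇q (⊆-trans ∁B⊆I I⊆∁B'))

basis-dual-∁ : (M : Indep n) (C : Subset n) → IsBasis (dual M) C → ∃ λ B → IsBasis M B × C ≡ ∁ B
basis-dual-∁ M C ((B , basisB , C⊆∁B) , maximalC) = B , basisB , sym (maximalC (∁ B) (B , basisB , ⊆-refl) C⊆∁B)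

dual-dual : (M : Indep n) (S : Subset n) → dual (dual M) S ⇔ (∃ λ B → IsBasis M B × S ⊆ B)
dual-dual M S = mk⇔ ⇒ ⇐
  where
  ⇒ : dual (dual M) S → ∃ λ B → IsBasis M B × S ⊆ B
  ⇒ (C , basisC , S⊆∁C) with basis-dual-∁ M C basisC
  ... | B , basisB , refl = B , basisB , λ x∈S → subst (_ ∈_) (∁-involutive B) (S⊆∁C x∈S)
  ⇐ : (∃ λ B → IsBasis M B × S ⊆ B) → dual (dual M) S
  ⇐ (B , basisB , S⊆B) = ∁ B , ∁-basis-dual M B basisB , λ x∈S → subst (_ ∈_) (sym (∁-involutive B)) (S⊆B x∈S)

-- The layered matroid of a chain

DescendingBelow : Subset n → List (Subset n) → Set
DescendingBelow U [] = Unit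
DescendingBelow U (C ∷ Cs) = C ⊂ U × DescendingBelow C Cs

LayerBounds : List (Subset n) → Subset n → Set
LayerBounds [] I = Unit
LayerBounds (C ∷ Cs) I = ∣ I ∩ C ∣ ≤ length Cs × LayerBounds Cs I

Layered : List (Subset n) → Indep n
Layered Cs I = LayerBounds Cs I × ∣ I ∣ ≤ length Cs

descendingBelow-⊆ : ∀ {U U' : Subset n} (Cs : List (Subset n)) → U ⊆ U' → DescendingBelow U Cs → DescendingBelow U' Cs
descendingBelow-⊆ [] _ _ = tt
descendingBelow-⊆ (C ∷ Cs) U⊆U' ((C⊆U , x , x∈U , x∉C) , desc) =
  ((λ y∈C → U⊆U' (C⊆U y∈C)) , x , U⊆U' x∈U , x∉C) , desc

-- The bounds on I only involve I ∩ U: a set S whose part inside U lies in I inherits them.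
layerBounds-transfer : ∀ {U S I : Subset n} (Cs : List (Subset n)) → DescendingBelow U Cs →
  (∀ {y} → y ∈ S → y ∈ U → y ∈ I) → LayerBounds Cs I → LayerBounds Cs S
layerBounds-transfer [] _ _ _ = tt
layerBounds-transfer {S = S} {I} (C ∷ Cs) ((C⊆U , _) , desc) S∩U⊆I (bound , bounds) =
  ≤-trans (p⊆q⇒∣p∣≤∣q∣ S∩C⊆I∩C) bound , layerBounds-transfer Cs desc (λ y∈S y∈C → S∩U⊆I y∈S (C⊆U y∈C)) bounds
  where
  S∩C⊆I∩C : S ∩ C ⊆ I ∩ C
  S∩C⊆I∩C y∈ = let y∈S , y∈C = x∈p∩q⁻ S C y∈ in x∈p∩q⁺ (S∩U⊆I y∈S (C⊆U y∈C) , y∈C)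

layerBounds-⊆ : ∀ {S I : Subset n} (Cs : List (Subset n)) → S ⊆ I → LayerBounds Cs I → LayerBounds Cs S
layerBounds-⊆ [] _ _ = tt
layerBounds-⊆ {S = S} {I} (C ∷ Cs) S⊆I (bound , bounds) =
  ≤-trans (p⊆q⇒∣p∣≤∣q∣ S∩C⊆I∩C) bound , layerBounds-⊆ Cs S⊆I bounds
  where
  S∩C⊆I∩C : S ∩ C ⊆ I ∩ C
  S∩C⊆I∩C y∈ = let y∈S , y∈C = x∈p∩q⁻ S C y∈ in x∈p∩q⁺ (S⊆I y∈S , y∈C)

layered-⊆ : ∀ {S I : Subset n} (Cs : List (Subset n)) → S ⊆ I → Layered Cs I → Layered Cs S
layered-⊆ Cs S⊆I (bounds , size) = layerBounds-⊆ Cs S⊆I bounds , ≤-trans (p⊆q⇒∣p∣≤∣q∣ S⊆I) size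

Addable : List (Subset n) → Subset n → Fin n → Set
Addable [] I x = Unit
Addable (C ∷ Cs) I x = (x ∈ C → suc ∣ I ∩ C ∣ ≤ length Cs) × Addable Cs I x

addable-outside : ∀ {U I : Subset n} {x} (Cs : List (Subset n)) → DescendingBelow U Cs → x ∉ U → Addable Cs I x
addable-outside [] _ _ = tt
addable-outside (C ∷ Cs) ((C⊆U , _) , desc) x∉U =
  (λ x∈C → ⊥-elim (x∉C x∈C)) , addable-outside Cs desc x∉C
  where
  x∉C : _ ∉ C
  x∉C x∈C = x∉U (C⊆U x∈C)

-- Either U ∖ C₁ has a point outside I, or
-- U ∖ C₁ ⊆ I, and then ∣ I ∩ C₁ ∣ < ∣ I ∩ U ∣ lets us recurse into C₁.
addable-point : ∀ {U I : Subset n} (Cs : List (Subset n)) → DescendingBelow U Cs → LayerBounds Cs I →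
  ∣ I ∩ U ∣ < length Cs → ∃ λ x → x ∈ U × x ∉ I × Addable Cs I x
addable-point {U = U} {I} (C ∷ Cs) ((C⊆U , y , y∈U , y∉C) , desc) (_ , bounds) ∣I∩U∣<
  with nonempty? ((U ─ C) ─ I)
... | yes (x , x∈) = let x∈U─C , x∉I = x∈p─q⁻ (U ─ C) I x∈ ; x∈U , x∉C = x∈p─q⁻ U C x∈U─C
                     in x , x∈U , x∉I , (λ x∈C → ⊥-elim (x∉C x∈C)) , addable-outside Cs desc x∉C
... | no U─C⊆I = let x , x∈C , x∉I , addable = addable-point Cs desc bounds ∣I∩C∣<
                 in x , C⊆U x∈C , x∉I , (λ _ → ∣I∩C∣<) , addable
  where
  y∈I : y ∈ I
  y∈I = nothing-outside I (U ─ C) U─C⊆I (x∈p∧x∉q⇒x∈p─q y∈U y∉C)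
  I∩C⊂I∩U : I ∩ C ⊂ I ∩ U
  I∩C⊂I∩U = (λ z∈ → let z∈I , z∈C = x∈p∩q⁻ I C z∈ in x∈p∩q⁺ (z∈I , C⊆U z∈C))
          , y , x∈p∩q⁺ (y∈I , y∈U) , λ y∈ → y∉C (p∩q⊆q I C y∈)
  ∣I∩C∣< : ∣ I ∩ C ∣ < length Cs
  ∣I∩C∣< = ≤-pred (≤-trans (s≤s (p⊂q⇒∣p∣<∣q∣ I∩C⊂I∩U)) ∣I∩U∣<)

insert-layerBounds : ∀ {I : Subset n} {x} (Cs : List (Subset n)) → Addable Cs I x → LayerBounds Cs I →
  LayerBounds Cs (⁅ x ⁆ ∪ I)
insert-layerBounds [] _ _ = tt
insert-layerBounds {I = I} {x} (C ∷ Cs) (addable , addables) (bound , bounds) =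
  bound' , insert-layerBounds Cs addables bounds
  where
  bound' : ∣ (⁅ x ⁆ ∪ I) ∩ C ∣ ≤ length Cs
  bound' with x ∈? C
  ... | yes x∈C = ≤-trans (∣⁅x⁆∪p∩q∣≤ x I C) (≤-trans (+-monoˡ-≤ _ (∣⁅x⁆∩q∣≤1 x C)) (addable x∈C))
  ... | no x∉C = ≤-trans (∣⁅x⁆∪p∩q∣≤ x I C)
                   (≤-trans (≤-reflexive (cong (_+ ∣ I ∩ C ∣) (∣p∩q∣≡0 (⁅x⁆-disjoint x∉C)))) bound)

module _ (Cs : List (Subset n)) (desc : DescendingBelow ⊤ Cs) where

  layered-augment : ∀ {I} → Layered Cs I → ∣ I ∣ < length Cs → ∃ λ x → x ∉ I × Layered Cs (⁅ x ⁆ ∪ I)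
  layered-augment {I} (bounds , _) ∣I∣< =
    let x , _ , x∉I , addable =
          addable-point Cs desc bounds (subst (_< length Cs) (cong ∣_∣ (sym (∩-identityʳ I))) ∣I∣<)
    in x , x∉I , insert-layerBounds Cs addable bounds , ≤-trans (≤-reflexive (∣⁅x⁆∪p∣≡1+∣p∣ x∉I)) ∣I∣<

  layered-extend : ∀ {I} → Layered Cs I → ∃ λ B → I ⊆ B × Layered Cs B × ∣ B ∣ ≡ length Cs
  layered-extend {I} indepI@(_ , ∣I∣≤k) = extend (length Cs ∸ ∣ I ∣) I (m∸n+n≡m ∣I∣≤k) indepI
    where
    extend : ∀ d I → d + ∣ I ∣ ≡ length Cs → Layered Cs I → ∃ λ B → I ⊆ B × Layered Cs B × ∣ B ∣ ≡ length Cs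
    extend zero I ∣I∣≡k indepI = I , ⊆-refl , indepI , ∣I∣≡k
    extend (suc d) I deficit indepI =
      let x , x∉I , indepI' = layered-augment indepI (≤-trans (s≤s (m≤n+m ∣ I ∣ d)) (≤-reflexive deficit))
          deficit' = trans (cong (d +_) (∣⁅x⁆∪p∣≡1+∣p∣ x∉I)) (trans (+-suc d _) deficit)
          B , I'⊆B , indepB , ∣B∣≡k = extend d (⁅ x ⁆ ∪ I) deficit' indepI'
      in B , (λ y∈I → I'⊆B (x∈p∪q⁺ (inj₂ y∈I))) , indepB , ∣B∣≡k

  layered-basis : ∀ B → IsBasis (Layered Cs) B ⇔ (Layered Cs B × ∣ B ∣ ≡ length Cs)
  layered-basis B = mk⇔ ⇒ ⇐
    where
    ⇒ : IsBasis (Layered Cs) B → Layered Cs B × ∣ B ∣ ≡ length Cs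
    ⇒ (indepB , maximal) = let B' , B⊆B' , indepB' , ∣B'∣≡k = layered-extend indepB
                           in indepB , subst (λ C → ∣ C ∣ ≡ length Cs) (maximal B' indepB' B⊆B') ∣B'∣≡k
    ⇐ : Layered Cs B × ∣ B ∣ ≡ length Cs → IsBasis (Layered Cs) B
    ⇐ (indepB , ∣B∣≡k) = indepB , λ I (_ , ∣I∣≤k) B⊆I → sym (⊆-card-≡ B⊆I (≤-trans ∣I∣≤k (≤-reflexive (sym ∣B∣≡k))))

  -- Since every independent set lies in a basis, L(Cs)** = L(Cs).
  layered-dual-dual : dual (dual (Layered Cs)) ≐ Layered Cs
  layered-dual-dual S = mk⇔
    (λ dd → let B , basisB , S⊆B = to (dual-dual (Layered Cs) S) dd in layered-⊆ Cs S⊆B (proj₁ basisB))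
    (λ indepS → let B , S⊆B , indepB , ∣B∣≡k = layered-extend indepS
                in from (dual-dual (Layered Cs) S) (B , from (layered-basis B) (indepB , ∣B∣≡k) , S⊆B))

  layered-dual : ∀ S → dual (Layered Cs) S ⇔ (∃ λ B → (Layered Cs B × ∣ B ∣ ≡ length Cs) × S ⊆ ∁ B)
  layered-dual S = mk⇔ (λ (B , basisB , S⊆∁B) → B , to (layered-basis B) basisB , S⊆∁B)
                       (λ (B , fullB , S⊆∁B) → B , from (layered-basis B) fullB , S⊆∁B)

layered-single-∉ : ∀ {G J : Subset n} {y} → Layered (G ∷ []) J → y ∈ J → y ∉ G
layered-single-∉ ((∣J∩G∣≤0 , _) , _) y∈J y∈G = ∣p∣≤0⇒x∉p ∣J∩G∣≤0 (x∈p∩q⁺ (y∈J , y∈G))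

layered-single-dual : (G : Subset n) → G ⊂ ⊤ → ∀ S → dual (Layered (G ∷ [])) S ⇔ (∃ λ x → x ∉ G × x ∉ S)
layered-single-dual {n} G G⊂⊤ S = mk⇔ ⇒ ⇐
  where
  ⇒ : dual (Layered (G ∷ [])) S → ∃ λ x → x ∉ G × x ∉ S
  ⇒ dualS with to (layered-dual (G ∷ []) (G⊂⊤ , tt) S) dualS
  ... | B , (indepB , ∣B∣≡1) , S⊆∁B with pick-outside ⊥ B (subst (_< ∣ B ∣) (sym (∣⊥∣≡0 n)) (≤-reflexive (sym ∣B∣≡1)))
  ... | x , x∈B , _ = x , layered-single-∉ indepB x∈B , λ x∈S → x∈p⇒x∉∁p x∈B (S⊆∁B x∈S)
  ⇐ : (∃ λ x → x ∉ G × x ∉ S) → dual (Layered (G ∷ [])) S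
  ⇐ (x , x∉G , x∉S) = from (layered-dual (G ∷ []) (G⊂⊤ , tt) S)
    (⁅ x ⁆ , (((≤-reflexive (∣p∩q∣≡0 (⁅x⁆-disjoint x∉G)) , tt) , ≤-reflexive (∣⁅x⁆∣≡1 x)) , ∣⁅x⁆∣≡1 x) , S⊆∁⁅x⁆)
    where
    S⊆∁⁅x⁆ : S ⊆ ∁ ⁅ x ⁆
    S⊆∁⁅x⁆ y∈S = x∉p⇒x∈∁p λ y∈⁅x⁆ → x∉S (subst (_∈ S) (x∈⁅y⁆⇒x≡y x y∈⁅x⁆) y∈S)

H-indep : (G : Subset n) → G ⊂ ⊤ → ∀ S → H G S ⇔ (∃ λ x → x ∉ G × x ∉ S)
H-indep G (_ , y , _ , y∉G) S = mk⇔ ⇒ ⇐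
  where
  T = ⊤ ─ G
  ∣T∣-1<∣T∣ : ∣ T ∣ ∸ 1 < ∣ T ∣
  ∣T∣-1<∣T∣ = ≤-reflexive (m+[n∸m]≡n (x∈p⇒0<∣p∣ (x∈p∧x∉q⇒x∈p─q ∈⊤ y∉G)))
  ⇒ : H G S → ∃ λ x → x ∉ G × x ∉ S
  ⇒ (_ , (_ , ∣S∩T∣≤)) with pick-outside (S ∩ T) T (≤-trans (s≤s ∣S∩T∣≤) ∣T∣-1<∣T∣)
  ... | x , x∈T , x∉S∩T = x , proj₂ (x∈p─q⁻ ⊤ G x∈T) , λ x∈S → x∉S∩T (x∈p∩q⁺ (x∈S , x∈T))
  ⇐ : (∃ λ x → x ∉ G × x ∉ S) → H G S
  ⇐ (x , x∉G , x∉S) = (p∩q⊆q S G , ∣p∩q∣≤∣q∣ S G) , (p∩q⊆q S T , ≤-trans (p⊆q⇒∣p∣≤∣q∣ S∩T⊆T-x) ∣T-x∣≤)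
    where
    x∈T = x∈p∧x∉q⇒x∈p─q ∈⊤ x∉G
    S∩T⊆T-x : S ∩ T ⊆ T - x
    S∩T⊆T-x z∈ = let z∈S , z∈T = x∈p∩q⁻ S T z∈
                 in x∈p∧x∉q⇒x∈p─q z∈T λ z∈⁅x⁆ → x∉S (subst (_∈ S) (x∈⁅y⁆⇒x≡y x z∈⁅x⁆) z∈S)
    ∣T-x∣≤ : ∣ T - x ∣ ≤ ∣ T ∣ ∸ 1
    ∣T-x∣≤ = ≤-reflexive (sym (cong (_∸ 1) (∣p∣≡1+∣p-x∣ x∈T)))

H≐dual-layered : (G : Subset n) → G ⊂ ⊤ → H G ≐ dual (Layered (G ∷ []))
H≐dual-layered G G⊂⊤ S = ⇔.trans (H-indep G G⊂⊤ S) (⇔.sym (layered-single-dual G G⊂⊤ S))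

-- Adding a new top member G to the chain is the same as taking the union with L(G):
-- the extra point allowed by the size bound must lie outside G.
layered-∨-single : (G : Subset n) (Cs : List (Subset n)) → DescendingBelow ⊤ (G ∷ Cs) →
  (Layered Cs ∨M Layered (G ∷ [])) ≐ Layered (G ∷ Cs)
layered-∨-single {n} G Cs (_ , desc) S = mk⇔ ⇒ ⇐
  where
  ⇒ : (Layered Cs ∨M Layered (G ∷ [])) S → Layered (G ∷ Cs) S
  ⇒ (I , J , (boundsI , ∣I∣≤) , indepJ@(_ , ∣J∣≤1) , refl) =
    (≤-trans (p⊆q⇒∣p∣≤∣q∣ (λ y∈ → let y∈S , y∈G = x∈p∩q⁻ (I ∪ J) G y∈ in inside-G⇒∈I y∈S y∈G)) ∣I∣≤ ,
     layerBounds-transfer Cs desc inside-G⇒∈I boundsI) ,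
    ≤-trans (∣p∪q∣≤∣p∣+∣q∣ I J) (≤-trans (+-mono-≤ ∣I∣≤ ∣J∣≤1) (≤-reflexive (+-comm _ 1)))
    where
    inside-G⇒∈I : ∀ {y} → y ∈ I ∪ J → y ∈ G → y ∈ I
    inside-G⇒∈I {y} y∈ y∈G with x∈p∪q⁻ I J y∈
    ... | inj₁ y∈I = y∈I
    ... | inj₂ y∈J = ⊥-elim (layered-single-∉ indepJ y∈J y∈G)
  -- a point of S outside G, if any, is put into the L(G) part
  ⇐ : Layered (G ∷ Cs) S → (Layered Cs ∨M Layered (G ∷ [])) S
  ⇐ ((∣S∩G∣≤ , bounds) , ∣S∣≤) with nonempty? (S ─ G)
  ... | yes (x , x∈) =
    let x∈S , x∉G = x∈p─q⁻ S G x∈ in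
    S - x , ⁅ x ⁆ ,
    (layerBounds-⊆ Cs (p─q⊆p S ⁅ x ⁆) bounds , ≤-pred (≤-trans (≤-reflexive (sym (∣p∣≡1+∣p-x∣ x∈S))) ∣S∣≤)) ,
    ((≤-reflexive (∣p∩q∣≡0 (⁅x⁆-disjoint x∉G)) , tt) , ≤-reflexive (∣⁅x⁆∣≡1 x)) ,
    sym (trans (∪-comm (S - x) ⁅ x ⁆) (⊆-split (⁅x⁆⊆p x∈S)))
  ... | no S⊆G = S , ⊥ ,
    (bounds , ≤-trans (p⊆q⇒∣p∣≤∣q∣ (λ y∈S → x∈p∩q⁺ (y∈S , nothing-outside G S S⊆G y∈S))) ∣S∩G∣≤) ,
    ((≤-reflexive (∣p∩q∣≡0 {q = G} (λ y∈⊥ _ → ∉⊥ y∈⊥)) , tt) , ∣⊥∣≤ {n} 1) ,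
    sym (∪-identityʳ S)

-- The chain product is the dual of the layered matroid

StrictChainFrom : ∀ {m} → Subset n → Vec (Subset n) m → Set
StrictChainFrom P [] = P ⊂ ⊤
StrictChainFrom P (G ∷ Gs) = P ⊂ G × StrictChainFrom G Gs

strictChainFrom : ∀ {m} {G} (Gs : Vec (Subset n) m) → StrictChain (G ∷ Gs) → last (G ∷ Gs) ⊂ ⊤ →
  StrictChainFrom G Gs
strictChainFrom [] single last⊂⊤ = last⊂⊤
strictChainFrom (G' ∷ Gs) (cons G⊂G' chain) last⊂⊤ = G⊂G' , strictChainFrom Gs chain last⊂⊤

reverseOnto : ∀ {A : Set} {m} → Vec A m → List A → List A
reverseOnto [] Cs = Cs
reverseOnto (G ∷ Gs) Cs = reverseOnto Gs (G ∷ Cs)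

ascending⇒descending : ∀ {m} {G} (Gs : Vec (Subset n) m) (Cs : List (Subset n)) →
  StrictChainFrom G Gs → DescendingBelow G Cs → DescendingBelow ⊤ (reverseOnto Gs (G ∷ Cs))
ascending⇒descending [] Cs G⊂⊤ desc = G⊂⊤ , desc
ascending⇒descending {G = G} (G' ∷ Gs) Cs (G⊂G' , chain) desc =
  ascending⇒descending Gs (G ∷ Cs) chain (G⊂G' , desc)

descending-suffix : ∀ {m} (Gs : Vec (Subset n) m) (Cs : List (Subset n)) →
  DescendingBelow ⊤ (reverseOnto Gs Cs) → DescendingBelow ⊤ Cs
descending-suffix [] Cs desc = desc
descending-suffix (G ∷ Gs) Cs desc =
  let _ , descCs = descending-suffix Gs (G ∷ Cs) desc in descendingBelow-⊆ Cs ⊆⊤ descCs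

-- M ∧ H_G = (M* ∨ H_G*)*: with M = L(Cs)* this is (L(Cs) ∨ L(G))* = L(G ∷ Cs)*.
∧H-step : (G : Subset n) (Cs : List (Subset n)) (M : Indep n) → DescendingBelow ⊤ (G ∷ Cs) →
  M ≐ dual (Layered Cs) → (M ∧M H G) ≐ dual (Layered (G ∷ Cs))
∧H-step G Cs M desc@(G⊂⊤ , descCs) M≐ = dual-resp (≐-trans (∨-resp M*≐ H*≐) (layered-∨-single G Cs desc))
  where
  M*≐ : dual M ≐ Layered Cs
  M*≐ = ≐-trans (dual-resp M≐) (layered-dual-dual Cs (descendingBelow-⊆ Cs ⊆⊤ descCs))
  H*≐ : dual (H G) ≐ Layered (G ∷ [])
  H*≐ = ≐-trans (dual-resp (H≐dual-layered G G⊂⊤)) (layered-dual-dual (G ∷ []) (G⊂⊤ , tt))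

chainProdAcc≐ : ∀ {m} (Gs : Vec (Subset n) m) (Cs : List (Subset n)) (M : Indep n) →
  DescendingBelow ⊤ (reverseOnto Gs Cs) → M ≐ dual (Layered Cs) →
  chainProdAcc M Gs ≐ dual (Layered (reverseOnto Gs Cs))
chainProdAcc≐ [] Cs M desc M≐ = M≐
chainProdAcc≐ (G ∷ Gs) Cs M desc M≐ =
  chainProdAcc≐ Gs (G ∷ Cs) (M ∧M H G) desc (∧H-step G Cs M (descending-suffix Gs (G ∷ Cs) desc) M≐)

chainProd≐dual-layered : ∀ {m} (G : Subset n) (Gs : Vec (Subset n) m) → StrictChainFrom G Gs →
  chainProd (G ∷ Gs) ≐ dual (Layered (reverseOnto (G ∷ Gs) []))
chainProd≐dual-layered G Gs chain =
  let desc = ascending⇒descending Gs [] chain tt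
  in chainProdAcc≐ Gs (G ∷ []) (H G) desc (H≐dual-layered G (proj₁ (descending-suffix Gs (G ∷ []) desc)))

-- Explicit description of the dual of the layered matroid
--
-- For the ascending chain G₁ ⊊ … ⊊ Gₖ, the bases of L(Gₖ,…,G₁) are the k-sets B
-- with ∣ B ∩ Gᵢ ∣ ≤ i − 1, i.e. with at least k − i + 1 points outside Gᵢ.
-- A set S avoids such a B iff for every i there is room for k − i + 1 points
-- outside Gᵢ ∪ S.

Room : ∀ {m} → Vec (Subset n) m → Subset n → Set
Room [] S = Unit
Room {m = suc m} (G ∷ Gs) S = ∣ S ─ G ∣ + suc m ≤ ∣ ⊤ ─ G ∣ × Room Gs S

Escapes : ∀ {m} → Vec (Subset n) m → Subset n → Set
Escapes [] B = Unit
Escapes {m = suc m} (G ∷ Gs) B = suc m ≤ ∣ B ─ G ∣ × Escapes Gs B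

WeakChainFrom : ∀ {m} → Subset n → Vec (Subset n) m → Set
WeakChainFrom P [] = Unit
WeakChainFrom P (G ∷ Gs) = P ⊆ G × WeakChainFrom G Gs

strict⇒weak : ∀ {m} {P : Subset n} (Gs : Vec (Subset n) m) → StrictChainFrom P Gs → WeakChainFrom P Gs
strict⇒weak [] _ = tt
strict⇒weak (G ∷ Gs) ((P⊆G , _) , chain) = P⊆G , strict⇒weak Gs chain

length-reverseOnto : ∀ {A : Set} {m} (Gs : Vec A m) (Cs : List A) → length (reverseOnto Gs Cs) ≡ m + length Cs
length-reverseOnto [] Cs = refl
length-reverseOnto {m = suc m} (G ∷ Gs) Cs = trans (length-reverseOnto Gs (G ∷ Cs)) (+-suc m _)

full-layerBounds⇔escapes : ∀ {m} (Gs : Vec (Subset n) m) (Cs : List (Subset n)) (B : Subset n) →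
  ∣ B ∣ ≡ length Cs + m → LayerBounds (reverseOnto Gs Cs) B ⇔ (LayerBounds Cs B × Escapes Gs B)
full-layerBounds⇔escapes [] Cs B _ = mk⇔ (λ bounds → bounds , tt) proj₁
full-layerBounds⇔escapes {m = suc m} (G ∷ Gs) Cs B ∣B∣≡ =
  ⇔.trans (full-layerBounds⇔escapes Gs (G ∷ Cs) B (trans ∣B∣≡ (+-suc (length Cs) m)))
          (mk⇔ (λ ((bound , bounds) , escapes) → bounds , to bound⇔escape bound , escapes)
               (λ (bounds , escape , escapes) → (from bound⇔escape escape , bounds) , escapes))
  where
  bound⇔escape : ∣ B ∩ G ∣ ≤ length Cs ⇔ suc m ≤ ∣ B ─ G ∣
  bound⇔escape = complement-≤ (∣ B ∩ G ∣) (∣ B ─ G ∣) (length Cs) (suc m) (trans (sym (∣p∣≡∣p∩q∣+∣p─q∣ B G)) ∣B∣≡)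

escapes-⊆ : ∀ {m} (Gs : Vec (Subset n) m) {B B'} → B' ⊆ B → Escapes Gs B' → Escapes Gs B
escapes-⊆ [] _ _ = tt
escapes-⊆ (G ∷ Gs) {B} {B'} B'⊆B (escape , escapes) =
  ≤-trans escape (p⊆q⇒∣p∣≤∣q∣ (λ y∈ → let y∈B' , y∉G = x∈p─q⁻ B' G y∈ in x∈p∧x∉q⇒x∈p─q (B'⊆B y∈B') y∉G)) ,
  escapes-⊆ Gs B'⊆B escapes

escapes⇒room : ∀ {m} (Gs : Vec (Subset n) m) {S B} → Escapes Gs B → Disjoint B S → Room Gs S
escapes⇒room [] _ _ = tt
escapes⇒room (G ∷ Gs) {S} {B} (escape , escapes) disj =
  ≤-trans (+-monoʳ-≤ ∣ S ─ G ∣ escape) (disjoint-≤ (S ─ G) (B ─ G) (⊤ ─ G) outside-G outside-G disj') ,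
  escapes⇒room Gs escapes disj
  where
  outside-G : ∀ {P} → P ─ G ⊆ ⊤ ─ G
  outside-G {P} y∈ = x∈p∧x∉q⇒x∈p─q ∈⊤ (proj₂ (x∈p─q⁻ P G y∈))
  disj' : Disjoint (S ─ G) (B ─ G)
  disj' y∈S─G y∈B─G = disj (p─q⊆p B G y∈B─G) (p─q⊆p S G y∈S─G)

free-points : ∀ {G S : Subset n} c → ∣ S ─ G ∣ + c ≤ ∣ ⊤ ─ G ∣ → c ≤ ∣ (⊤ ─ G) ─ S ∣
free-points {G = G} {S} c room = +-cancelˡ-≤ (∣ S ─ G ∣) c (∣ (⊤ ─ G) ─ S ∣) (begin
  ∣ S ─ G ∣ + c                             ≤⟨ room ⟩
  ∣ ⊤ ─ G ∣                                 ≡⟨ ∣p∣≡∣p∩q∣+∣p─q∣ (⊤ ─ G) S ⟩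
  ∣ (⊤ ─ G) ∩ S ∣ + ∣ (⊤ ─ G) ─ S ∣          ≤⟨ +-monoˡ-≤ ∣ (⊤ ─ G) ─ S ∣ (p⊆q⇒∣p∣≤∣q∣ ⊤─G∩S⊆S─G) ⟩
  ∣ S ─ G ∣ + ∣ (⊤ ─ G) ─ S ∣                ∎)
  where
  open ≤-Reasoning
  ⊤─G∩S⊆S─G : (⊤ ─ G) ∩ S ⊆ S ─ G
  ⊤─G∩S⊆S─G y∈ = let y∈⊤─G , y∈S = x∈p∩q⁻ (⊤ ─ G) S y∈ in x∈p∧x∉q⇒x∈p─q y∈S (proj₂ (x∈p─q⁻ ⊤ G y∈⊤─G))

-- Conversely, if S has room, an escaping k-set B disjoint from S (and from any
-- P below the chain) is built greedily from the top: by induction B' avoids G₁,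
-- and the room at G₁ leaves a point of E ∖ (G₁ ∪ S) outside B'.
escaping-set : ∀ {m} (P : Subset n) (Gs : Vec (Subset n) m) {S} → WeakChainFrom P Gs → Room Gs S →
  ∃ λ B → Disjoint B S × Disjoint B P × ∣ B ∣ ≡ m × Escapes Gs B
escaping-set {n} P [] _ _ = ⊥ , (λ y∈⊥ _ → ∉⊥ y∈⊥) , (λ y∈⊥ _ → ∉⊥ y∈⊥) , ∣⊥∣≡0 n , tt
escaping-set {m = suc m} P (G ∷ Gs) {S} (P⊆G , chain) (room , rooms)
  with escaping-set G Gs chain rooms
... | B' , B'-S , B'-G , ∣B'∣≡m , escapes
  with pick-outside B' ((⊤ ─ G) ─ S) (subst (_< ∣ (⊤ ─ G) ─ S ∣) (sym ∣B'∣≡m) (free-points {G = G} {S} (suc m) room))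
... | x , x∈free , x∉B' =
  ⁅ x ⁆ ∪ B' , B-S , (λ y∈B y∈P → B-G y∈B (P⊆G y∈P)) , ∣B∣≡ ,
  ≤-trans (≤-reflexive (sym ∣B∣≡)) (p⊆q⇒∣p∣≤∣q∣ (λ y∈B → x∈p∧x∉q⇒x∈p─q y∈B (B-G y∈B))) ,
  escapes-⊆ Gs (q⊆p∪q ⁅ x ⁆ B') escapes
  where
  x∈⊤─G = proj₁ (x∈p─q⁻ (⊤ ─ G) S x∈free)
  B-S : Disjoint (⁅ x ⁆ ∪ B') S
  B-S = ∪-disjoint (⁅x⁆-disjoint (proj₂ (x∈p─q⁻ (⊤ ─ G) S x∈free))) B'-S
  B-G : Disjoint (⁅ x ⁆ ∪ B') G
  B-G = ∪-disjoint (⁅x⁆-disjoint (proj₂ (x∈p─q⁻ ⊤ G x∈⊤─G))) B'-G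
  ∣B∣≡ : ∣ ⁅ x ⁆ ∪ B' ∣ ≡ suc m
  ∣B∣≡ = trans (∣⁅x⁆∪p∣≡1+∣p∣ x∉B') (cong suc ∣B'∣≡m)

dual-layered≐room : ∀ {m} (G : Subset n) (Gs : Vec (Subset n) m) → StrictChainFrom G Gs →
  dual (Layered (reverseOnto (G ∷ Gs) [])) ≐ Room (G ∷ Gs)
dual-layered≐room {m = m} G Gs chain S = mk⇔ ⇒ ⇐
  where
  Cs = reverseOnto (G ∷ Gs) []
  desc = ascending⇒descending Gs [] chain tt
  k≡ : length Cs ≡ suc m
  k≡ = trans (length-reverseOnto (G ∷ Gs) []) (+-identityʳ (suc m))
  ⇒ : dual (Layered Cs) S → Room (G ∷ Gs) S
  ⇒ dualS with to (layered-dual Cs desc S) dualS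
  ... | B , ((bounds , _) , ∣B∣≡k) , S⊆∁B =
    escapes⇒room (G ∷ Gs) (proj₂ (to (full-layerBounds⇔escapes (G ∷ Gs) [] B (trans ∣B∣≡k k≡)) bounds))
                 (λ y∈B y∈S → x∈p⇒x∉∁p y∈B (S⊆∁B y∈S))
  ⇐ : Room (G ∷ Gs) S → dual (Layered Cs) S
  ⇐ room with escaping-set ⊥ (G ∷ Gs) (⊥⊆ , strict⇒weak Gs chain) room
  ... | B , B-S , _ , ∣B∣≡ , escapes =
    from (layered-dual Cs desc S)
      (B , ((from (full-layerBounds⇔escapes (G ∷ Gs) [] B ∣B∣≡) (tt , escapes) , ≤-reflexive ∣B∣≡k) , ∣B∣≡k) ,
       λ y∈S → x∉p⇒x∈∁p λ y∈B → B-S y∈B y∈S)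
    where
    ∣B∣≡k : ∣ B ∣ ≡ length Cs
    ∣B∣≡k = trans ∣B∣≡ (sym k≡)

-- Transversal matroids: peeling off one member of the family
--
-- A partial transversal of (X, A₁, …, Aₘ) is a set of at most one point of X
-- together with a disjoint partial transversal of (A₁, …, Aₘ).

maybeSet : Maybe (Fin n) → Subset n
maybeSet nothing = ⊥
maybeSet (just x) = ⁅ x ⁆

∈maybeSet⇔ : ∀ (v : Maybe (Fin n)) y → y ∈ maybeSet v ⇔ v ≡ just y
∈maybeSet⇔ nothing y = mk⇔ (λ y∈⊥ → ⊥-elim (∉⊥ y∈⊥)) (λ ())
∈maybeSet⇔ (just x) y = mk⇔ (λ y∈⁅x⁆ → cong just (sym (x∈⁅y⁆⇒x≡y x y∈⁅x⁆))) (λ { refl → x∈⁅x⁆ y })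

∣maybeSet∣≤1 : (v : Maybe (Fin n)) → ∣ maybeSet v ∣ ≤ 1
∣maybeSet∣≤1 {n} nothing = ∣⊥∣≤ {n} 1
∣maybeSet∣≤1 (just x) = ≤-reflexive (∣⁅x⁆∣≡1 x)

≤1⇒maybeSet : {I : Subset n} → ∣ I ∣ ≤ 1 → ∃ λ v → ∀ y → y ∈ I ⇔ v ≡ just y
≤1⇒maybeSet {I = I} ∣I∣≤1 with nonempty? I
... | yes (x , x∈I) = just x , λ y → mk⇔ (λ y∈I → cong just (sym (unique y∈I))) (λ { refl → x∈I })
  where
  unique : ∀ {y} → y ∈ I → y ≡ x
  unique {y} y∈I with y ≟F x
  ... | yes y≡x = y≡x
  ... | no y≢x = ⊥-elim (1+n≰n (≤-trans (s≤s (x∈p⇒0<∣p∣ (x∈p∧x≢y⇒x∈p-y y∈I y≢x)))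
                                        (≤-trans (≤-reflexive (sym (∣p∣≡1+∣p-x∣ x∈I))) ∣I∣≤1)))
... | no I-empty = nothing , λ y → mk⇔ (λ y∈I → ⊥-elim (I-empty (y , y∈I))) (λ ())

transversal-uncons : (X : Subset n) (A : List (Subset n)) (S : Subset n) →
  Transversal (X ∷ A) S → (U 1 X ∨M Transversal A) S
transversal-uncons X A S (ψ , ψ∈ , ψ-injective , image) =
  I , S ─ I ,
  ((λ y∈I → ψ∈ zero _ (to (∈maybeSet⇔ (ψ zero) _) y∈I)) , ∣maybeSet∣≤1 (ψ zero)) ,
  ((λ j → ψ (suc j)) , (λ j → ψ∈ (suc j)) , (λ j j' y p q → fsuc-injective (ψ-injective (suc j) (suc j') y p q)) ,
   tail-image) ,
  sym (⊆-split I⊆S)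
  where
  I = maybeSet (ψ zero)
  I⊆S : I ⊆ S
  I⊆S y∈I = from (image _) (zero , to (∈maybeSet⇔ (ψ zero) _) y∈I)
  tail-image : ∀ y → y ∈ S ─ I ⇔ ∃ λ j → ψ (suc j) ≡ just y
  tail-image y = mk⇔ ⇒ ⇐
    where
    ⇒ : y ∈ S ─ I → ∃ λ j → ψ (suc j) ≡ just y
    ⇒ y∈ with x∈p─q⁻ S I y∈
    ... | y∈S , y∉I with to (image y) y∈S
    ...   | zero , ψ0≡y = ⊥-elim (y∉I (from (∈maybeSet⇔ (ψ zero) y) ψ0≡y))
    ...   | suc j , ψj≡y = j , ψj≡y
    ⇐ : (∃ λ j → ψ (suc j) ≡ just y) → y ∈ S ─ I
    ⇐ (j , ψj≡y) = x∈p∧x∉q⇒x∈p─q (from (image y) (suc j , ψj≡y))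
                     λ y∈I → fzero≢fsuc (ψ-injective zero (suc j) y (to (∈maybeSet⇔ (ψ zero) y) y∈I) ψj≡y)

without : Maybe (Fin n) → Maybe (Fin n) → Maybe (Fin n)
without (just x) (just y) with y ≟F x
... | yes _ = nothing
... | no _ = just y
without _ w = w

without-just : ∀ (v w : Maybe (Fin n)) {y} → without v w ≡ just y → w ≡ just y × v ≢ just y
without-just nothing w p = p , λ ()
without-just (just x) nothing ()
without-just (just x) (just z) p with z ≟F x
without-just (just x) (just z) () | yes _
without-just (just x) (just z) refl | no z≢x = refl , λ x≡z → z≢x (sym (just-injective x≡z))

without-keep : ∀ (v w : Maybe (Fin n)) {y} → w ≡ just y → v ≢ just y → without v w ≡ just y
without-keep nothing w p _ = p
without-keep (just x) (just y) refl v≢y with y ≟F x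
... | yes refl = ⊥-elim (v≢y refl)
... | no _ = refl

-- Conversely, a point of X placed at position 0 extends a matching of A;
-- the point is removed from the tail so the extension stays injective.
transversal-cons : (X : Subset n) (A : List (Subset n)) (S : Subset n) →
  (U 1 X ∨M Transversal A) S → Transversal (X ∷ A) S
transversal-cons {n} X A _ (I , J , (I⊆X , ∣I∣≤1) , (ψ' , ψ'∈ , ψ'-injective , image') , refl)
  with ≤1⇒maybeSet ∣I∣≤1
... | v , ∈I⇔ = ψ , ψ∈ , ψ-injective , image
  where
  ψ : Fin (suc (length A)) → Maybe (Fin n)
  ψ zero = v
  ψ (suc j) = without v (ψ' j)
  ψ∈ : ∀ j y → ψ j ≡ just y → y ∈ lookup (X ∷ A) j
  ψ∈ zero y p = I⊆X (from (∈I⇔ y) p)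
  ψ∈ (suc j) y p = ψ'∈ j y (proj₁ (without-just v (ψ' j) p))
  ψ-injective : ∀ j j' y → ψ j ≡ just y → ψ j' ≡ just y → j ≡ j'
  ψ-injective zero zero y p q = refl
  ψ-injective zero (suc j') y p q = ⊥-elim (proj₂ (without-just v (ψ' j') q) p)
  ψ-injective (suc j) zero y p q = ⊥-elim (proj₂ (without-just v (ψ' j) p) q)
  ψ-injective (suc j) (suc j') y p q =
    cong suc (ψ'-injective j j' y (proj₁ (without-just v (ψ' j) p)) (proj₁ (without-just v (ψ' j') q)))
  image : ∀ y → y ∈ I ∪ J ⇔ ∃ λ j → ψ j ≡ just y
  image y = mk⇔ ⇒ ⇐
    where
    ⇒ : y ∈ I ∪ J → ∃ λ j → ψ j ≡ just y
    ⇒ y∈ with y ∈? I | x∈p∪q⁻ I J y∈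
    ... | yes y∈I | _ = zero , to (∈I⇔ y) y∈I
    ... | no y∉I | inj₁ y∈I = ⊥-elim (y∉I y∈I)
    ... | no y∉I | inj₂ y∈J =
      let j , p = to (image' y) y∈J in suc j , without-keep v (ψ' j) p (λ q → y∉I (from (∈I⇔ y) q))
    ⇐ : (∃ λ j → ψ j ≡ just y) → y ∈ I ∪ J
    ⇐ (zero , p) = x∈p∪q⁺ (inj₁ (from (∈I⇔ y) p))
    ⇐ (suc j , p) = x∈p∪q⁺ (inj₂ (from (image' y) (j , proj₁ (without-just v (ψ' j) p))))

transversal-∷ : (X : Subset n) (A : List (Subset n)) → Transversal (X ∷ A) ≐ (U 1 X ∨M Transversal A)
transversal-∷ X A S = mk⇔ (transversal-uncons X A S) (transversal-cons X A S)

U₁∨U∨ : (X : Subset n) (a : ℕ) (N : Indep n) → (U 1 X ∨M (U a X ∨M N)) ≐ (U (suc a) X ∨M N)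
U₁∨U∨ {n} X a N S = mk⇔ ⇒ ⇐
  where
  ⇒ : (U 1 X ∨M (U a X ∨M N)) S → (U (suc a) X ∨M N) S
  ⇒ (I₁ , _ , (I₁⊆X , ∣I₁∣≤1) , (I₂ , J , (I₂⊆X , ∣I₂∣≤a) , indepJ , refl) , refl) =
    I₁ ∪ I₂ , J , (I₁∪I₂⊆X , ≤-trans (∣p∪q∣≤∣p∣+∣q∣ I₁ I₂) (+-mono-≤ ∣I₁∣≤1 ∣I₂∣≤a)) , indepJ , sym (∪-assoc I₁ I₂ J)
    where
    I₁∪I₂⊆X : I₁ ∪ I₂ ⊆ X
    I₁∪I₂⊆X y∈ with x∈p∪q⁻ I₁ I₂ y∈
    ... | inj₁ y∈I₁ = I₁⊆X y∈I₁
    ... | inj₂ y∈I₂ = I₂⊆X y∈I₂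
  -- one point of I, if any, is moved to the U_{1,X} part
  ⇐ : (U (suc a) X ∨M N) S → (U 1 X ∨M (U a X ∨M N)) S
  ⇐ (I , J , (I⊆X , ∣I∣≤1+a) , indepJ , refl) with nonempty? I
  ... | yes (x , x∈I) =
    ⁅ x ⁆ , (I - x) ∪ J , (⊆-trans (⁅x⁆⊆p x∈I) I⊆X , ≤-reflexive (∣⁅x⁆∣≡1 x)) ,
    (I - x , J , (⊆-trans (p─q⊆p I ⁅ x ⁆) I⊆X , ≤-pred (≤-trans (≤-reflexive (sym (∣p∣≡1+∣p-x∣ x∈I))) ∣I∣≤1+a)) ,
     indepJ , refl) ,
    trans (cong (_∪ J) (sym (⊆-split (⁅x⁆⊆p x∈I)))) (∪-assoc ⁅ x ⁆ (I - x) J)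
  ... | no I-empty =
    ⊥ , I ∪ J , (⊥⊆ , ∣⊥∣≤ {n} 1) ,
    (I , J , (I⊆X , ≤-trans (≤-reflexive (∣∅∣≡0 I-empty)) z≤n) , indepJ , refl) ,
    sym (∪-identityˡ (I ∪ J))

transversal-replicate : (a : ℕ) (X : Subset n) (A : List (Subset n)) →
  Transversal (replicate a X ++ A) ≐ (U a X ∨M Transversal A)
transversal-replicate {n} zero X A S = mk⇔ ⇒ ⇐
  where
  ⇒ : Transversal A S → (U 0 X ∨M Transversal A) S
  ⇒ indepS = ⊥ , S , (⊥⊆ , ≤-reflexive (∣⊥∣≡0 n)) , indepS , sym (∪-identityˡ S)
  ⇐ : (U 0 X ∨M Transversal A) S → Transversal A S
  ⇐ (I , J , (_ , ∣I∣≤0) , indepJ , refl) =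
    subst (Transversal A) (sym (trans (cong (_∪ J) (∣p∣≤0⇒p≡⊥ ∣I∣≤0)) (∪-identityˡ J))) indepJ
transversal-replicate (suc a) X A =
  ≐-trans (transversal-∷ X (replicate a X ++ A))
  (≐-trans (∨-resp ≐-refl (transversal-replicate a X A)) (U₁∨U∨ X a (Transversal A)))

-- Unions with a uniform matroid

U∨bounded : (X : Subset n) (a b : ℕ) (Q : Subset n → Set) →
  (∀ {S J} → J ⊆ S → Q S → Q J) → (∀ {S J} → S ─ X ⊆ J → Q J → Q S) →
  (U a X ∨M (λ S → ∣ S ∣ ≤ b × Q S)) ≐ (λ S → ∣ S ∣ ≤ a + b × ∣ S ─ X ∣ ≤ b × Q S)
U∨bounded X a b Q Q-⊆ Q-outside S = mk⇔ ⇒ ⇐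
  where
  ⇒ : (U a X ∨M (λ S → ∣ S ∣ ≤ b × Q S)) S → ∣ S ∣ ≤ a + b × ∣ S ─ X ∣ ≤ b × Q S
  ⇒ (I , J , (I⊆X , ∣I∣≤a) , (∣J∣≤b , QJ) , refl) =
    ≤-trans (∣p∪q∣≤∣p∣+∣q∣ I J) (+-mono-≤ ∣I∣≤a ∣J∣≤b) , ≤-trans (p⊆q⇒∣p∣≤∣q∣ S─X⊆J) ∣J∣≤b , Q-outside S─X⊆J QJ
    where
    S─X⊆J : (I ∪ J) ─ X ⊆ J
    S─X⊆J y∈ with x∈p─q⁻ (I ∪ J) X y∈
    ... | y∈S , y∉X with x∈p∪q⁻ I J y∈S
    ...   | inj₁ y∈I = ⊥-elim (y∉X (I⊆X y∈I))
    ...   | inj₂ y∈J = y∈J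
  split : ∀ {P} → P ⊆ S ∩ X → ∣ P ∣ ≤ a → ∣ S ─ P ∣ ≤ b → Q S → (U a X ∨M (λ S → ∣ S ∣ ≤ b × Q S)) S
  split {P} P⊆S∩X ∣P∣≤a ∣S─P∣≤b QS =
    P , S ─ P , ((λ y∈P → p∩q⊆q S X (P⊆S∩X y∈P)) , ∣P∣≤a) , (∣S─P∣≤b , Q-⊆ (p─q⊆p S P) QS) ,
    sym (⊆-split (λ y∈P → p∩q⊆p S X (P⊆S∩X y∈P)))
  ⇐ : ∣ S ∣ ≤ a + b × ∣ S ─ X ∣ ≤ b × Q S → (U a X ∨M (λ S → ∣ S ∣ ≤ b × Q S)) S
  ⇐ (∣S∣≤a+b , ∣S─X∣≤b , QS) with a ≤? ∣ S ∩ X ∣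
  -- enough points inside X: put exactly a of them into P
  ... | yes a≤ with subset-of-size (S ∩ X) a a≤
  ...   | P , P⊆S∩X , ∣P∣≡a = split P⊆S∩X (≤-reflexive ∣P∣≡a) (+-cancelˡ-≤ a _ _ (begin
          a + ∣ S ─ P ∣     ≡⟨ cong (_+ ∣ S ─ P ∣) (sym ∣P∣≡a) ⟩
          ∣ P ∣ + ∣ S ─ P ∣ ≡⟨ sym (∣p∣≡∣q∣+∣p─q∣ (λ y∈P → p∩q⊆p S X (P⊆S∩X y∈P))) ⟩
          ∣ S ∣             ≤⟨ ∣S∣≤a+b ⟩
          a + b             ∎)) QS
    where open ≤-Reasoning
  -- few points inside X: put all of them into P
  ⇐ (∣S∣≤a+b , ∣S─X∣≤b , QS) | no a≰ =
    split ⊆-refl (<⇒≤ (≰⇒> a≰)) (≤-trans (≤-reflexive ∣S─S∩X∣≡∣S─X∣) ∣S─X∣≤b) QS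
    where
    ∣S─S∩X∣≡∣S─X∣ : ∣ S ─ (S ∩ X) ∣ ≡ ∣ S ─ X ∣
    ∣S─S∩X∣≡∣S─X∣ = +-cancelˡ-≡ ∣ S ∩ X ∣ _ _
      (trans (sym (∣p∣≡∣q∣+∣p─q∣ (p∩q⊆p S X))) (∣p∣≡∣p∩q∣+∣p─q∣ S X))

-- The transversal matroid of the chain family

room-⊆ : ∀ {m} (Gs : Vec (Subset n) m) {S J} → J ⊆ S → Room Gs S → Room Gs J
room-⊆ [] _ _ = tt
room-⊆ (G ∷ Gs) {S} {J} J⊆S (room , rooms) = ≤-trans (+-monoˡ-≤ _ (p⊆q⇒∣p∣≤∣q∣ J─G⊆S─G)) room , room-⊆ Gs J⊆S rooms
  where
  J─G⊆S─G : J ─ G ⊆ S ─ G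
  J─G⊆S─G y∈ = let y∈J , y∉G = x∈p─q⁻ J G y∈ in x∈p∧x∉q⇒x∈p─q (J⊆S y∈J) y∉G

room-outside : ∀ {m} (X : Subset n) (Gs : Vec (Subset n) m) {S J} → WeakChainFrom X Gs →
  S ─ X ⊆ J → Room Gs J → Room Gs S
room-outside X [] _ _ _ = tt
room-outside X (G ∷ Gs) {S} {J} (X⊆G , chain) S─X⊆J (room , rooms) =
  ≤-trans (+-monoˡ-≤ _ (p⊆q⇒∣p∣≤∣q∣ S─G⊆J─G)) room , room-outside G Gs chain S─G⊆J rooms
  where
  S─G⊆J : S ─ G ⊆ J
  S─G⊆J y∈ = let y∈S , y∉G = x∈p─q⁻ S G y∈ in S─X⊆J (x∈p∧x∉q⇒x∈p─q y∈S (λ y∈X → y∉G (X⊆G y∈X)))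
  S─G⊆J─G : S ─ G ⊆ J ─ G
  S─G⊆J─G y∈ = x∈p∧x∉q⇒x∈p─q (S─G⊆J y∈) (proj₂ (x∈p─q⁻ S G y∈))

transversal-[] : Transversal {n} [] ≐ (λ S → ∣ S ∣ ≤ 0 × Unit)
transversal-[] S = mk⇔ ⇒ ⇐
  where
  ⇒ : Transversal [] S → ∣ S ∣ ≤ 0 × Unit
  ⇒ (_ , _ , _ , image) = ≤-reflexive (∣∅∣≡0 λ (y , y∈S) → ¬Fin0 (proj₁ (to (image y) y∈S))) , tt
  ⇐ : ∣ S ∣ ≤ 0 × Unit → Transversal [] S
  ⇐ (∣S∣≤0 , _) = (λ ()) , (λ ()) , (λ ()) , λ y → mk⇔ (λ y∈S → ⊥-elim (∣p∣≤0⇒x∉p ∣S∣≤0 y∈S)) (λ { (() , _) })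

transversal-block : (a : ℕ) (X : Subset n) (A : List (Subset n)) (b : ℕ) (Q : Subset n → Set) →
  (∀ {S J} → J ⊆ S → Q S → Q J) → (∀ {S J} → S ─ X ⊆ J → Q J → Q S) →
  Transversal A ≐ (λ S → ∣ S ∣ ≤ b × Q S) →
  Transversal (replicate a X ++ A) ≐ (λ S → ∣ S ∣ ≤ a + b × ∣ S ─ X ∣ ≤ b × Q S)
transversal-block a X A b Q Q-⊆ Q-outside A≐ =
  ≐-trans (transversal-replicate a X A) (≐-trans (∨-resp ≐-refl A≐) (U∨bounded X a b Q Q-⊆ Q-outside))

chain-length≤ : ∀ {m} (P : Subset n) (Gs : Vec (Subset n) m) → StrictChainFrom P Gs → suc m ≤ ∣ ⊤ ─ P ∣
chain-length≤ P [] P⊂⊤ = 0<∣G─P∣ P⊂⊤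
chain-length≤ {m = suc m} P (G ∷ Gs) (P⊂G , chain) =
  ≤-trans (+-mono-≤ (0<∣G─P∣ P⊂G) (chain-length≤ G Gs chain)) (≤-reflexive (sym (∣⊤─P∣≡∣G─P∣+∣⊤─G∣ (proj₁ P⊂G))))

room-head : ∀ {m} (G S : Subset n) → suc m ≤ ∣ ⊤ ─ G ∣ → ∣ S ─ G ∣ ≤ ∣ ⊤ ─ G ∣ ∸ suc m ⇔ ∣ S ─ G ∣ + suc m ≤ ∣ ⊤ ─ G ∣
room-head G S m<∣⊤─G∣ = mk⇔ (m≤o∸n⇒m+n≤o _ m<∣⊤─G∣) (m+n≤o⇒m≤o∸n _)

transversal-tail : ∀ {m} (P : Subset n) (Gs : Vec (Subset n) m) → StrictChainFrom P Gs →
  Transversal (familyTail P Gs) ≐ (λ S → ∣ S ∣ ≤ ∣ ⊤ ─ P ∣ ∸ suc m × Room Gs S)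
transversal-tail {n} P [] _ S =
  ⇔.trans (subst (λ A → Transversal A S ⇔ Transversal (replicate c ⊤ ++ []) S) (++-identityʳ (replicate c ⊤)) ⇔.refl)
  (⇔.trans (transversal-block c ⊤ [] 0 (λ _ → Unit) (λ _ _ → tt) (λ _ _ → tt) transversal-[] S)
  (mk⇔ (λ (∣S∣≤c+0 , _ , _) → subst (∣ S ∣ ≤_) (+-identityʳ c) ∣S∣≤c+0 , tt)
       (λ (∣S∣≤c , _) → subst (∣ S ∣ ≤_) (sym (+-identityʳ c)) ∣S∣≤c ,
                        ≤-reflexive (trans (cong ∣_∣ (p─⊤≡⊥ S)) (∣⊥∣≡0 n)) , tt)))
  where
  c = ∣ ⊤ ─ P ∣ ∸ 1
transversal-tail {m = suc m} P (G ∷ Gs) (P⊂G , chain) =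
  ≐-trans (transversal-block a G (familyTail G Gs) b (Room Gs) (room-⊆ Gs) (room-outside G Gs (strict⇒weak Gs chain))
                             (transversal-tail G Gs chain))
  λ S → mk⇔ (λ (∣S∣≤a+b , ∣S─G∣≤b , rooms) → subst (∣ S ∣ ≤_) a+b≡ ∣S∣≤a+b , to (room-head G S m<) ∣S─G∣≤b , rooms)
            (λ (∣S∣≤ , room , rooms) → subst (∣ S ∣ ≤_) (sym a+b≡) ∣S∣≤ , from (room-head G S m<) room , rooms)
  where
  a = ∣ G ─ P ∣ ∸ 1
  b = ∣ ⊤ ─ G ∣ ∸ suc m
  m< : suc m ≤ ∣ ⊤ ─ G ∣
  m< = chain-length≤ G Gs chain
  a+b≡ : a + b ≡ ∣ ⊤ ─ P ∣ ∸ suc (suc m)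
  a+b≡ = trans (∸-split (∣ G ─ P ∣) (∣ ⊤ ─ G ∣) (suc m) (0<∣G─P∣ P⊂G) m<)
               (cong (_∸ suc (suc m)) (sym (∣⊤─P∣≡∣G─P∣+∣⊤─G∣ (proj₁ P⊂G))))

-- The chain family: the first block G₁^{⊕|G₁|} can absorb all of S ∩ G₁, so only Room remains.
transversal-chainFamily : ∀ {m} (G : Subset n) (Gs : Vec (Subset n) m) → StrictChainFrom G Gs →
  Transversal (chainFamily (G ∷ Gs)) ≐ Room (G ∷ Gs)
transversal-chainFamily {m = m} G Gs chain =
  ≐-trans (transversal-block ∣ G ∣ G (familyTail G Gs) b (Room Gs) (room-⊆ Gs) (room-outside G Gs (strict⇒weak Gs chain))
                             (transversal-tail G Gs chain))
  λ S → mk⇔ (λ (_ , ∣S─G∣≤b , rooms) → to (room-head G S m<) ∣S─G∣≤b , rooms)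
            (λ (room , rooms) → let ∣S─G∣≤b = from (room-head G S m<) room in
               ≤-trans (≤-reflexive (∣p∣≡∣p∩q∣+∣p─q∣ S G)) (+-mono-≤ (∣p∩q∣≤∣q∣ S G) ∣S─G∣≤b) , ∣S─G∣≤b , rooms)
  where
  b = ∣ ⊤ ─ G ∣ ∸ suc m
  m< : suc m ≤ ∣ ⊤ ─ G ∣
  m< = chain-length≤ G Gs chain

proposition5p4 : (n : ℕ) → 2 ≤ n → (m : ℕ) → (Gs : Vec (Subset n) (suc m)) →
    StrictChain Gs → ∣ last Gs ∣ ≤ n ∸ 2 →
    (S : Subset n) → chainProd Gs S ⇔ Transversal (chainFamily Gs) S
proposition5p4 n 2≤n m (G ∷ Gs) strict ∣Gₖ∣≤n-2 S =
  ⇔.trans (chainProd≐dual-layered G Gs chain S)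
  (⇔.trans (dual-layered≐room G Gs chain S)
           (⇔.sym (transversal-chainFamily G Gs chain S)))
  where
  -- |Gₖ| ≤ n − 2 < n, so the whole chain is strict up to E
  chain : StrictChainFrom G Gs
  chain = strictChainFrom Gs strict (⊂⊤ (last (G ∷ Gs)) (≤-trans (s≤s ∣Gₖ∣≤n-2) (∸-monoʳ-< (s≤s z≤n) 2≤n)))
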